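{- Let $n\ge2$ and let $\mathsf u$ be any subword of $\boldsymbol\lambda_n$. Write $\mathsf r^{\mathsf u}=[r_1,\dots,r_\ell]$ and let $i_j$ be the index (position in $\boldsymbol\lambda_n$) of the skip corresponding to $r_j$. Then for each $j$, \[(r_1\cdots r_{j-1})\,r_j\,(r_{j-1}\cdots r_1)=\Big(\!\!\Big(0,\ i_j+\Big\lfloor\frac{i_j-1}{n-1}\Big\rfloor\Big)\!\!\Big).\]
   Context: $\widetilde S_n$ is the affine symmetric group (bijections $w:\mathbb Z\to\mathbb Z$ with $w(i+n)=w(i)+n$ and $\sum_{i=1}^n w(i)=\binom{n+1}{2}$, multiplied by composition $(vw)(k)=v(w(k))$). For $i\not\equiv j\pmod n$, $(\!(i,j)\!)$ interchanges $i+kn$ and $j+kn$ for all $k$ and fixes other integers; $s_j=(\!(j,j+1)\!)$. $\boldsymbol\lambda_n$ is the word $[s_0,\dots,s_{n-1}]$ repeated $n-1$ times; its $j$-th letter ($1\le j\le n(n-1)$) is $s_{j-1}$. A subword is $\mathsf u=[u_1,\dots,u_{n(n-1)}]$ with each $u_j$ either the $j$-th letter or the identity $e$ (a skip); $u_{(j)}=u_1\cdots u_j$, $u_{(0)}=e$. For $1\le j\le n(n-1)$ let $t_j=u_{(j-1)}s_{j-1}u_{(j-1)}^{ -1}$; $\mathsf r^{\mathsf u}$ is the sequence of $t_j$ over the skip indices $j$, in increasing order of $j$. -}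

module Defs where

open import Data.Bool using (Bool; true; false; if_then_else_)
open import Data.Nat as ℕ using (ℕ; zero; suc; _∸_; _≡ᵇ_)
open import Data.Integer as ℤ using (ℤ; +_; _%ℕ_; _-_)
open import Data.List using (List; []; _∷_; filterᵇ; applyUpTo; map; foldr)
open import Data.Product using (_×_; _,_; proj₁)
open import Function using (_∘_; id)

-- Residue of an integer modulo n (convention: n = 0 is never used,
-- since n ≥ 2 throughout; we return 0 there only to stay total).

_modN_ : ℤ → ℕ → ℕ
x modN zero    = 0
x modN (suc m) = x %ℕ suc m

-- ⌊ a / d ⌋ on naturals (d = 0 never used; returns 0 to stay total).
_divN_ : ℕ → ℕ → ℕ
a divN zero    = 0
a divN (suc d) = a ℕ./ suc d

-- Elements of the affine symmetric group, represented by a map ℤ → ℤ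
-- together with its inverse map.  Every element occurring in the
-- statement is a product of the generators s_j and their inverses, each
-- carrying its genuine inverse, so 'fwd' is the permutation itself.

record Aff : Set where
  constructor aff
  field
    fwd : ℤ → ℤ
    bwd : ℤ → ℤ
open Aff public

e : Aff
e = aff id id

_·_ : Aff → Aff → Aff
v · w = aff (fwd v ∘ fwd w) (bwd w ∘ bwd v)
infixl 7 _·_

_⁻¹ : Aff → Aff
w ⁻¹ = aff (bwd w) (fwd w)

prod : List Aff → Aff
prod = foldr _·_ e

-- The map ((i , j)) (for i ≢ j mod n): interchanges i + kn and j + kn
-- for all k, fixes all other integers.

transpFun : ℕ → ℤ → ℤ → ℤ → ℤ
transpFun n i j x =
  if (x modN n) ≡ᵇ (i modN n) then x ℤ.+ (j - i)
  else if (x modN n) ≡ᵇ (j modN n) then x ℤ.+ (i - j)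
  else x

⦅_,_⦆[_] : ℤ → ℤ → ℕ → Aff
⦅ i , j ⦆[ n ] = aff (transpFun n i j) (transpFun n i j)

s[_]_ : ℕ → ℤ → Aff
s[ n ] j = ⦅ j , j ℤ.+ ℤ.1ℤ ⦆[ n ]

-- The word λ_n = [s_0,…,s_{n-1}] repeated n-1 times has length
-- n(n-1); its j-th letter (1 ≤ j ≤ n(n-1)) is s_{j-1}.

wordLength : ℕ → ℕ
wordLength n = n ℕ.* (n ∸ 1)

letter : ℕ → ℕ → Aff
letter n j = s[ n ] (+ (j ∸ 1))

-- A subword u of λ_n is given by a list of flags of length n(n-1):
-- flag j (1-based) is 'true' iff u_j = e (a skip), and 'false' iff
-- u_j is the j-th letter.

-- flag j of a flag list (1-based; out of range reads as 'false')
flagAt : List Bool → ℕ → Bool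
flagAt []       _             = false
flagAt (b ∷ bs) zero          = false
flagAt (b ∷ bs) (suc zero)    = b
flagAt (b ∷ bs) (suc (suc j)) = flagAt bs (suc j)

uLetter : ℕ → List Bool → ℕ → Aff
uLetter n u j = if flagAt u j then e else letter n j

uPrefix : ℕ → List Bool → ℕ → Aff
uPrefix n u zero    = e
uPrefix n u (suc k) = uPrefix n u k · uLetter n u (suc k)

tElt : ℕ → List Bool → ℕ → Aff
tElt n u j = uPrefix n u (j ∸ 1) · letter n j · (uPrefix n u (j ∸ 1)) ⁻¹

skipIndices : ℕ → List Bool → List ℕ
skipIndices n u = filterᵇ (flagAt u) (applyUpTo suc (wordLength n))

-- r^u together with the skip indices: the list of pairs (i_j , r_j)
rWithIndex : ℕ → List Bool → List (ℕ × Aff)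
rWithIndex n u = map (λ i → i , tElt n u i) (skipIndices n u)

-- Let w_a = s_0 s_1 ⋯ s_(a-1) be the prefix of λ_n of length a, with no skips. Walking along
-- u, the reflections r_1, …, r_k collected at the skips among the first a positions satisfy
-- (r_1 ⋯ r_k) u_(a) = w_a: a letter kept in u extends both sides by s_a, and a skip at a+1
-- contributes r_(k+1) = u_(a) s_a u_(a)⁻¹. Hence, the r's being involutions, the conjugate in
-- the theorem equals w_a s_a w_a⁻¹ for the skip position a+1. Since w_a commutes with
-- translation by n, conjugating ((a, a+1)) by it gives ((w_a(a), w_a(a+1))). Finally
-- w_a(a) = 0, and the shift identity w_(a+1)(1 + x) = s_0(1 + w_a(x)) computes
-- w_a(a+1) = a + 1 + ⌊a/(n-1)⌋ by induction on a.

module Submission where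

open import Defs
open import Data.Bool using (Bool; true; false; if_then_else_)
open import Data.Bool.Properties using (T-≡; ¬-not)
open import Data.Empty using (⊥-elim)
open import Data.Fin using (Fin; zero; suc; toℕ)
import Data.Integer as ℤ
open import Data.Integer using (ℤ; +_; -[1+_])
import Data.Integer.DivMod as ℤ
import Data.Integer.Properties as ℤ
open import Data.Integer.Tactic.RingSolver using (solve-∀)
open import Data.List using (List; []; _∷_; [_]; _++_; _∷ʳ_; length; lookup; take; drop; map; reverse; filterᵇ; applyUpTo; initLast; _∷ʳ′_)
import Data.List.Properties as List
open import Data.List.Relation.Unary.All using (All; []; _∷_)
import Data.List.Relation.Unary.All.Properties as All
open import Data.Nat as ℕ using (ℕ; zero; suc; _<_; _≤_; _∸_; s≤s; z≤n)
import Data.Nat.DivMod as ℕ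
open import Data.Nat.Divisibility using (divides-refl)
import Data.Nat.Properties as ℕ
open import Data.Nat.Tactic.RingSolver using () renaming (solve-∀ to ℕ-solve-∀)
open import Data.Product using (∃; _×_; _,_; proj₁; proj₂)
open import Data.Sum using (_⊎_; inj₁; inj₂)
open import Data.Vec using (Vec; toList)
open import Function using (id; _∘_; _$_; Equivalence)
open import Function.Definitions using (Injective; StrictlyInverseˡ; StrictlyInverseʳ)
open import Relation.Binary.Definitions using (Decidable)
open import Relation.Binary.PropositionalEquality using (_≡_; _≢_; refl; sym; trans; cong; cong₂; subst; module ≡-Reasoning)
open import Relation.Nullary using (¬_; yes; no)
open import Relation.Nullary.Decidable using (map′; T?)
open import Algebra.Definitions {A = ℤ} _≡_ using (Involutive)
open import Algebra.Properties.AbelianGroup ℤ.+-0-abelianGroup using (∙-cancelˡ)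
open import Algebra.Properties.CommutativeSemigroup ℤ.+-commutativeSemigroup using (xy∙z≈xz∙y)

take-lookup-drop : ∀ {A : Set} (xs : List A) (i : Fin (length xs)) →
                   xs ≡ take (toℕ i) xs ++ lookup xs i ∷ drop (suc (toℕ i)) xs
take-lookup-drop (x ∷ xs) zero    = refl
take-lookup-drop (x ∷ xs) (suc i) = cong (x ∷_) (take-lookup-drop xs i)

∷ʳ-split : ∀ {A : Set} {xs : List A} {x P p rest} → xs ∷ʳ x ≡ P ++ p ∷ rest →
           (P ≡ xs × p ≡ x) ⊎ ∃ λ rest′ → xs ≡ P ++ p ∷ rest′
∷ʳ-split {xs = xs} {x} {P} {p} {rest} e with initLast rest
... | []          = inj₁ (List.∷ʳ-injective P xs (sym e))
... | rest′ ∷ʳ′ y = inj₂ (rest′ , sym (proj₁ (List.∷ʳ-injective (P ++ p ∷ rest′) xs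
                                      (trans (List.++-assoc P (p ∷ rest′) [ y ]) (sym e)))))

prod-++ : ∀ ws vs x → fwd (prod (ws ++ vs)) x ≡ fwd (prod ws) (fwd (prod vs) x)
prod-++ []       vs x = refl
prod-++ (w ∷ ws) vs x = cong (fwd w) (prod-++ ws vs x)

prod-reverse : ∀ {ws} → All (Involutive ∘ fwd) ws → ∀ x → fwd (prod ws) (fwd (prod (reverse ws)) x) ≡ x
prod-reverse []                          x = refl
prod-reverse {w ∷ ws} (w-invol ∷ ws-invol) x = begin
  fwd w (fwd (prod ws) (fwd (prod (reverse (w ∷ ws))) x))   ≡⟨ cong (fwd w ∘ fwd (prod ws)) reverse-snoc ⟩
  fwd w (fwd (prod ws) (fwd (prod (reverse ws)) (fwd w x)))  ≡⟨ cong (fwd w) (prod-reverse ws-invol (fwd w x)) ⟩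
  fwd w (fwd w x)                                            ≡⟨ w-invol x ⟩
  x                                                          ∎
  where
  open ≡-Reasoning
  reverse-snoc : fwd (prod (reverse (w ∷ ws))) x ≡ fwd (prod (reverse ws)) (fwd w x)
  reverse-snoc = trans (cong (λ l → fwd (prod l) x) (List.unfold-reverse w ws)) (prod-++ (reverse ws) [ w ] x)

-- Nothing in Aff forces bwd to invert fwd, so this is a property to be proved.
Invertible : Aff → Set
Invertible w = StrictlyInverseˡ _≡_ (fwd w) (bwd w) × StrictlyInverseʳ _≡_ (fwd w) (bwd w)

·-invertible : ∀ {v w} → Invertible v → Invertible w → Invertible (v · w)
·-invertible {v} {w} (v-fb , v-bf) (w-fb , w-bf) =
  (λ y → trans (cong (fwd v) (w-fb (bwd v y))) (v-fb y)) ,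
  (λ x → trans (cong (bwd w) (v-bf (fwd w x))) (w-bf x))

module Transpositions (m : ℕ) where

  open import Data.Integer using (_+_; _-_; _*_; -_)

  n : ℕ
  n = suc m

  infix 4 _≡ₙ_ _≡ₙ?_

  -- A record rather than a synonym, so that x and y can be inferred from a proof.
  record _≡ₙ_ (x y : ℤ) : Set where
    constructor same-residue
    field residue-≡ : x modN n ≡ y modN n
  open _≡ₙ_

  _≡ₙ?_ : Decidable _≡ₙ_
  x ≡ₙ? y = map′ same-residue residue-≡ (x modN n ℕ.≟ y modN n)

  ≡ₙ-sym : ∀ {x y} → x ≡ₙ y → y ≡ₙ x
  ≡ₙ-sym (same-residue e) = same-residue (sym e)

  ≡ₙ-trans : ∀ {x y z} → x ≡ₙ y → y ≡ₙ z → x ≡ₙ z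
  ≡ₙ-trans (same-residue e) (same-residue e′) = same-residue (trans e e′)

  residue-unique : ∀ {r s} k → r < n → s < n → + r ≡ + s + k * + n → r ≡ s
  residue-unique {r} {s} (+ zero)  r<n s<n e = trans (ℤ.+-injective e) (ℕ.+-identityʳ s)
  residue-unique {r} {s} (+ suc j) r<n s<n e = ⊥-elim (ℕ.<⇒≱ r<n (begin
    n                  ≤⟨ ℕ.m≤m+n n (j ℕ.* n) ⟩
    suc j ℕ.* n        ≤⟨ ℕ.m≤n+m _ s ⟩
    s ℕ.+ suc j ℕ.* n  ≡⟨ ℤ.+-injective e ⟨
    r                  ∎))
    where open ℕ.≤-Reasoning
  residue-unique {r} {s} -[1+ j ]  r<n s<n e = sym (residue-unique (+ suc j) s<n r<n (begin
    + s                                     ≡⟨ add-sub (+ s) (+ suc j) (+ n) ⟩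
    (+ s + -[1+ j ] * + n) + + suc j * + n  ≡⟨ cong (_+ + suc j * + n) (sym e) ⟩
    + r + + suc j * + n                     ∎))
    where
    open ≡-Reasoning
    add-sub : ∀ a t c → a ≡ (a + - t * c) + t * c
    add-sub = solve-∀

  private
    residue-decomposition : ∀ x → x ≡ + (x modN n) + (x ℤ./ℕ n) * + n
    residue-decomposition x = ℤ.a≡a%ℕn+[a/ℕn]*n x n

  ≡ₙ⇒multiple : ∀ {x y} → x ≡ₙ y → ∃ λ k → x ≡ y + k * + n
  ≡ₙ⇒multiple {x} {y} (same-residue x≡y) = qx - qy , (begin
    x                                 ≡⟨ residue-decomposition x ⟩
    + (x modN n) + qx * + n           ≡⟨ cong (λ r → + r + qx * + n) x≡y ⟩
    + (y modN n) + qx * + n           ≡⟨ regroup (+ (y modN n)) qx qy (+ n) ⟩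
    (+ (y modN n) + qy * + n) + (qx - qy) * + n ≡⟨ cong (_+ (qx - qy) * + n) (residue-decomposition y) ⟨
    y + (qx - qy) * + n               ∎)
    where
    open ≡-Reasoning
    qx qy : ℤ
    qx = x ℤ./ℕ n
    qy = y ℤ./ℕ n
    regroup : ∀ r p q c → r + p * c ≡ (r + q * c) + (p - q) * c
    regroup = solve-∀

  multiple⇒≡ₙ : ∀ {x y} k → x ≡ y + k * + n → x ≡ₙ y
  multiple⇒≡ₙ {x} {y} k e = same-residue $ residue-unique (qy + k - qx) (ℤ.n%ℕd<d x n) (ℤ.n%ℕd<d y n) (begin
    + (x modN n)                                  ≡⟨ regroup (+ (x modN n)) qx (+ n) ⟩
    (+ (x modN n) + qx * + n) - qx * + n          ≡⟨ cong (_- qx * + n) (trans (sym (residue-decomposition x)) e) ⟩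
    (y + k * + n) - qx * + n                      ≡⟨ cong (λ z → (z + k * + n) - qx * + n) (residue-decomposition y) ⟩
    ((+ (y modN n) + qy * + n) + k * + n) - qx * + n ≡⟨ collect (+ (y modN n)) qy k qx (+ n) ⟩
    + (y modN n) + (qy + k - qx) * + n            ∎)
    where
    open ≡-Reasoning
    qx qy : ℤ
    qx = x ℤ./ℕ n
    qy = y ℤ./ℕ n
    regroup : ∀ r p c → r ≡ (r + p * c) - p * c
    regroup = solve-∀
    collect : ∀ r q k p c → ((r + q * c) + k * c) - p * c ≡ r + (q + k - p) * c
    collect = solve-∀

  ≡ₙ-move : ∀ {i j x} → x ≡ₙ i → x + (j - i) ≡ₙ j
  ≡ₙ-move {i} {j} {x} x≡i with ≡ₙ⇒multiple x≡i
  ... | k , refl = multiple⇒≡ₙ k (shift i (k * + n) j)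
    where
    shift : ∀ a c b → a + c + (b - a) ≡ b + c
    shift = solve-∀

  private
    ≡⇒≡ᵇ≡true : ∀ {a b} → a ≡ b → (a ℕ.≡ᵇ b) ≡ true
    ≡⇒≡ᵇ≡true {a} {b} a≡b = Equivalence.to T-≡ (ℕ.≡⇒≡ᵇ a b a≡b)

    ≢⇒≡ᵇ≡false : ∀ {a b} → a ≢ b → (a ℕ.≡ᵇ b) ≡ false
    ≢⇒≡ᵇ≡false {a} {b} a≢b = ¬-not (a≢b ∘ ℕ.≡ᵇ⇒≡ a b ∘ Equivalence.from T-≡)

  transp-fst : ∀ {i j x} → x ≡ₙ i → transpFun n i j x ≡ x + (j - i)
  transp-fst (same-residue x≡i) rewrite ≡⇒≡ᵇ≡true x≡i = refl

  transp-snd : ∀ {i j x} → ¬ x ≡ₙ i → x ≡ₙ j → transpFun n i j x ≡ x + (i - j)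
  transp-snd x≢i (same-residue x≡j) rewrite ≢⇒≡ᵇ≡false (x≢i ∘ same-residue) | ≡⇒≡ᵇ≡true x≡j = refl

  transp-other : ∀ {i j x} → ¬ x ≡ₙ i → ¬ x ≡ₙ j → transpFun n i j x ≡ x
  transp-other x≢i x≢j rewrite ≢⇒≡ᵇ≡false (x≢i ∘ same-residue) | ≢⇒≡ᵇ≡false (x≢j ∘ same-residue) = refl

  private
    there-and-back : ∀ x i j → x + (j - i) + (i - j) ≡ x
    there-and-back = solve-∀

  transp-involutive : ∀ {i j} → ¬ i ≡ₙ j → Involutive (transpFun n i j)
  transp-involutive {i} {j} i≢j x with x ≡ₙ? i | x ≡ₙ? j
  ... | yes x≡i | _ = begin
    transpFun n i j (transpFun n i j x) ≡⟨ cong (transpFun n i j) (transp-fst x≡i) ⟩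
    transpFun n i j (x + (j - i))       ≡⟨ transp-snd (λ y≡i → i≢j (≡ₙ-trans (≡ₙ-sym y≡i) (≡ₙ-move x≡i))) (≡ₙ-move x≡i) ⟩
    x + (j - i) + (i - j)               ≡⟨ there-and-back x i j ⟩
    x                                   ∎
    where open ≡-Reasoning
  ... | no x≢i | yes x≡j = begin
    transpFun n i j (transpFun n i j x) ≡⟨ cong (transpFun n i j) (transp-snd x≢i x≡j) ⟩
    transpFun n i j (x + (i - j))       ≡⟨ transp-fst {j = j} (≡ₙ-move {j = i} x≡j) ⟩
    x + (i - j) + (j - i)               ≡⟨ there-and-back x j i ⟩
    x                                   ∎
    where open ≡-Reasoning
  ... | no x≢i | no x≢j = trans (cong (transpFun n i j) (transp-other x≢i x≢j)) (transp-other x≢i x≢j)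

  Equivariant : (ℤ → ℤ) → Set
  Equivariant σ = ∀ x k → σ (x + k * + n) ≡ σ x + k * + n

  transp-equivariant : ∀ i j → Equivariant (transpFun n i j)
  transp-equivariant i j x k
    rewrite residue-≡ (multiple⇒≡ₙ {x + k * + n} {x} k refl)
    with x modN n ℕ.≡ᵇ i modN n | x modN n ℕ.≡ᵇ j modN n
  ... | true  | _     = xy∙z≈xz∙y x (k * + n) (j - i)
  ... | false | true  = xy∙z≈xz∙y x (k * + n) (i - j)
  ... | false | false = refl

  module _ {σ : ℤ → ℤ} (σ-injective : Injective _≡_ _≡_ σ) (σ-equivariant : Equivariant σ) where

    ≡ₙ-image : ∀ {x y} → x ≡ₙ y → σ x ≡ₙ σ y
    ≡ₙ-image {x} {y} x≡y with ≡ₙ⇒multiple x≡y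
    ... | k , refl = multiple⇒≡ₙ k (σ-equivariant y k)

    ≡ₙ-preimage : ∀ {x y} → σ x ≡ₙ σ y → x ≡ₙ y
    ≡ₙ-preimage {x} {y} σx≡σy with ≡ₙ⇒multiple σx≡σy
    ... | k , e = multiple⇒≡ₙ k (σ-injective (trans e (sym (σ-equivariant y k))))

    private
      image-of-move : ∀ {i j x} → x ≡ₙ i → σ (x + (j - i)) ≡ σ x + (σ j - σ i)
      image-of-move {i} {j} {x} x≡i with ≡ₙ⇒multiple x≡i
      ... | k , refl = begin
        σ (i + k * + n + (j - i))     ≡⟨ cong σ (shift i (k * + n) j) ⟩
        σ (j + k * + n)               ≡⟨ σ-equivariant j k ⟩
        σ j + k * + n                 ≡⟨ shift (σ i) (k * + n) (σ j) ⟨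
        σ i + k * + n + (σ j - σ i)   ≡⟨ cong (_+ (σ j - σ i)) (σ-equivariant i k) ⟨
        σ (i + k * + n) + (σ j - σ i) ∎
        where
        open ≡-Reasoning
        shift : ∀ a c b → a + c + (b - a) ≡ b + c
        shift = solve-∀

    transp-conjugate : ∀ i j x → σ (transpFun n i j x) ≡ transpFun n (σ i) (σ j) (σ x)
    transp-conjugate i j x with x ≡ₙ? i | x ≡ₙ? j
    ... | yes x≡i | _ =
      trans (cong σ (transp-fst x≡i)) (trans (image-of-move x≡i) (sym (transp-fst (≡ₙ-image x≡i))))
    ... | no x≢i | yes x≡j =
      trans (cong σ (transp-snd x≢i x≡j))
            (trans (image-of-move x≡j) (sym (transp-snd (x≢i ∘ ≡ₙ-preimage) (≡ₙ-image x≡j))))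
    ... | no x≢i | no x≢j =
      trans (cong σ (transp-other x≢i x≢j)) (sym (transp-other (x≢i ∘ ≡ₙ-preimage) (x≢j ∘ ≡ₙ-preimage)))

  transp-shift : ∀ i j x → + 1 + transpFun n i j x ≡ transpFun n (+ 1 + i) (+ 1 + j) (+ 1 + x)
  transp-shift = transp-conjugate (λ {x} {y} → ∙-cancelˡ (+ 1) x y) (λ x k → sym (ℤ.+-assoc (+ 1) x (k * + n)))

module LambdaWord (k : ℕ) where

  open import Data.Integer using (_+_; _-_)
  open Transpositions (suc k)

  d : ℕ
  d = suc k

  s : ℕ → ℤ → ℤ
  s a = fwd (s[ n ] (+ a))

  private
    succ-minus-self : ∀ x → x + ℤ.1ℤ + (+ 0 - x) ≡ + 1
    succ-minus-self = solve-∀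

    succ-back : ∀ x → x + ℤ.1ℤ + (x - (x + ℤ.1ℤ)) ≡ x
    succ-back = solve-∀

  ≢ₙ-succ : ∀ x → ¬ x ≡ₙ x + ℤ.1ℤ
  ≢ₙ-succ x h with subst (_≡ₙ + 0) (succ-minus-self x) (≡ₙ-move (≡ₙ-sym h))
  ... | same-residue ()

  s-involutive : ∀ a → Involutive (s a)
  s-involutive a = transp-involutive (≢ₙ-succ (+ a))

  s-injective : ∀ a → Injective _≡_ _≡_ (s a)
  s-injective a {x} {y} e = trans (sym (s-involutive a x)) (trans (cong (s a) e) (s-involutive a y))

  s-succ : ∀ a → s a (+ a + ℤ.1ℤ) ≡ + a
  s-succ a = trans (transp-snd {+ a} {+ a + ℤ.1ℤ} (≢ₙ-succ (+ a) ∘ ≡ₙ-sym) (same-residue refl)) (succ-back (+ a))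

  s-shift : ∀ a x → s (suc a) (+ 1 + x) ≡ + 1 + s a x
  s-shift a x = sym (transp-shift (+ a) (+ a + ℤ.1ℤ) x)

  fullPrefix : ℕ → ℤ → ℤ
  fullPrefix zero    = id
  fullPrefix (suc a) = fullPrefix a ∘ s a

  fullPrefix-injective : ∀ a → Injective _≡_ _≡_ (fullPrefix a)
  fullPrefix-injective zero    = id
  fullPrefix-injective (suc a) = s-injective a ∘ fullPrefix-injective a

  fullPrefix-equivariant : ∀ a → Equivariant (fullPrefix a)
  fullPrefix-equivariant zero    x k = refl
  fullPrefix-equivariant (suc a) x k =
    trans (cong (fullPrefix a) (transp-equivariant (+ a) (+ a + ℤ.1ℤ) x k)) (fullPrefix-equivariant a (s a x) k)

  fullPrefix-self : ∀ a → fullPrefix a (+ a) ≡ + 0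
  fullPrefix-self zero    = refl
  fullPrefix-self (suc a) = begin
    fullPrefix a (s a (+ suc a))     ≡⟨ cong (fullPrefix a ∘ s a ∘ +_) (ℕ.+-comm 1 a) ⟩
    fullPrefix a (s a (+ a + ℤ.1ℤ))  ≡⟨ cong (fullPrefix a) (s-succ a) ⟩
    fullPrefix a (+ a)               ≡⟨ fullPrefix-self a ⟩
    + 0                              ∎
    where open ≡-Reasoning

  fullPrefix-shift : ∀ a x → fullPrefix (suc a) (+ 1 + x) ≡ s 0 (+ 1 + fullPrefix a x)
  fullPrefix-shift zero    x = refl
  fullPrefix-shift (suc a) x = begin
    fullPrefix (suc a) (s (suc a) (+ 1 + x)) ≡⟨ cong (fullPrefix (suc a)) (s-shift a x) ⟩
    fullPrefix (suc a) (+ 1 + s a x)         ≡⟨ fullPrefix-shift a (s a x) ⟩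
    s 0 (+ 1 + fullPrefix (suc a) x)         ∎
    where open ≡-Reasoning

  partner : ℕ → ℕ
  partner a = suc a ℕ.+ a ℕ./ d

  partner-decomposition : ∀ q r → r < d → partner (r ℕ.+ q ℕ.* d) ≡ suc r ℕ.+ q ℕ.* n
  partner-decomposition q r r<d = begin
    suc (r ℕ.+ q ℕ.* d) ℕ.+ (r ℕ.+ q ℕ.* d) ℕ./ d  ≡⟨ cong (suc (r ℕ.+ q ℕ.* d) ℕ.+_) quotient ⟩
    suc (r ℕ.+ q ℕ.* d) ℕ.+ q                      ≡⟨ regroup r q k ⟩
    suc r ℕ.+ q ℕ.* n                              ∎
    where
    open ≡-Reasoning
    quotient : (r ℕ.+ q ℕ.* d) ℕ./ d ≡ q
    quotient = begin
      (r ℕ.+ q ℕ.* d) ℕ./ d      ≡⟨ ℕ.+-distrib-/-∣ʳ r (divides-refl q) ⟩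
      r ℕ./ d ℕ.+ q ℕ.* d ℕ./ d  ≡⟨ cong₂ ℕ._+_ (ℕ.m<n⇒m/n≡0 r<d) (ℕ.m*n/n≡m q d) ⟩
      q                          ∎
    regroup : ∀ r q k → suc (r ℕ.+ q ℕ.* suc k) ℕ.+ q ≡ suc r ℕ.+ q ℕ.* suc (suc k)
    regroup = ℕ-solve-∀

  -- With a = r + q(n-1) and r < n-1, one more than the partner of a is (r+2) + qn. It is fixed
  -- by s_0 unless r = n-2, where it is a multiple of n and ⌊a/(n-1)⌋ increases at a+1.
  s0-partner : ∀ a → s 0 (+ suc (partner a)) ≡ + partner (suc a)
  s0-partner a = subst (λ a → s 0 (+ suc (partner a)) ≡ + partner (suc a))
    (sym (ℕ.m≡m%n+[m/n]*n a d)) (on-decomposition (a ℕ./ d) (a ℕ.% d) (ℕ.m%n<n a d))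
    where
    on-decomposition : ∀ q r → r < d → s 0 (+ suc (partner (r ℕ.+ q ℕ.* d))) ≡ + partner (suc (r ℕ.+ q ℕ.* d))
    on-decomposition q r r<d with ℕ.m≤n⇒m<n∨m≡n r<d
    ... | inj₁ 1+r<d = begin
      s 0 (+ suc (partner (r ℕ.+ q ℕ.* d)))  ≡⟨ cong (s 0 ∘ +_ ∘ suc) (partner-decomposition q r r<d) ⟩
      s 0 (+ (suc (suc r) ℕ.+ q ℕ.* n))      ≡⟨ transp-other {+ 0} {+ 1} (λ { (same-residue e) → ℕ.0≢1+n (trans (sym e) residue) })
                                                  (λ { (same-residue e) → ℕ.0≢1+n (ℕ.suc-injective (trans (sym e) residue)) }) ⟩
      + (suc (suc r) ℕ.+ q ℕ.* n)            ≡⟨ cong +_ (partner-decomposition q (suc r) 1+r<d) ⟨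
      + partner (suc r ℕ.+ q ℕ.* d)          ∎
      where
      open ≡-Reasoning
      residue : (suc (suc r) ℕ.+ q ℕ.* n) ℕ.% n ≡ suc (suc r)
      residue = trans (ℕ.[m+kn]%n≡m%n (suc (suc r)) q n) (ℕ.m<n⇒m%n≡m (s≤s 1+r<d))
    ... | inj₂ refl = begin
      s 0 (+ suc (partner (k ℕ.+ q ℕ.* d)))  ≡⟨ cong (s 0 ∘ +_ ∘ suc) (partner-decomposition q k r<d) ⟩
      s 0 (+ (suc q ℕ.* n))                  ≡⟨ transp-fst {+ 0} {+ 1} {+ (suc q ℕ.* n)} (same-residue (ℕ.m*n%n≡0 (suc q) n)) ⟩
      + (suc q ℕ.* n ℕ.+ 1)                  ≡⟨ cong +_ (ℕ.+-comm (suc q ℕ.* n) 1) ⟩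
      + (1 ℕ.+ suc q ℕ.* n)                  ≡⟨ cong +_ (partner-decomposition (suc q) 0 (s≤s z≤n)) ⟨
      + partner (suc q ℕ.* d)                ∎
      where open ≡-Reasoning

  fullPrefix-succ : ∀ a → fullPrefix a (+ a + ℤ.1ℤ) ≡ + partner a
  fullPrefix-succ zero    = refl
  fullPrefix-succ (suc a) = begin
    fullPrefix (suc a) (+ 1 + (+ a + ℤ.1ℤ)) ≡⟨ fullPrefix-shift a (+ a + ℤ.1ℤ) ⟩
    s 0 (+ 1 + fullPrefix a (+ a + ℤ.1ℤ))   ≡⟨ cong (λ x → s 0 (+ 1 + x)) (fullPrefix-succ a) ⟩
    s 0 (+ suc (partner a))                 ≡⟨ s0-partner a ⟩
    + partner (suc a)                       ∎
    where open ≡-Reasoning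

  fullPrefix-conjugate : ∀ a y → fullPrefix a (s a y) ≡ transpFun n (+ 0) (+ partner a) (fullPrefix a y)
  fullPrefix-conjugate a y = begin
    fullPrefix a (s a y)
      ≡⟨ transp-conjugate (fullPrefix-injective a) (fullPrefix-equivariant a) (+ a) (+ a + ℤ.1ℤ) y ⟩
    transpFun n (fullPrefix a (+ a)) (fullPrefix a (+ a + ℤ.1ℤ)) (fullPrefix a y)
      ≡⟨ cong₂ (λ i j → transpFun n i j (fullPrefix a y)) (fullPrefix-self a) (fullPrefix-succ a) ⟩
    transpFun n (+ 0) (+ partner a) (fullPrefix a y)
      ∎
    where open ≡-Reasoning

  module Subword (u : List Bool) where

    -- The pairs of rWithIndex at skip positions ≤ a; rWithIndex n u is indexedRUpTo (n(n-1)) by definition.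
    indexedRUpTo : ℕ → List (ℕ × Aff)
    indexedRUpTo a = map (λ i → i , tElt n u i) (filterᵇ (flagAt u) (applyUpTo suc a))

    indexedRUpTo-suc : ∀ a → indexedRUpTo (suc a) ≡ indexedRUpTo a ++ (if flagAt u (suc a) then [ (suc a , tElt n u (suc a)) ] else [])
    indexedRUpTo-suc a = begin
      indexedRUpTo (suc a)
        ≡⟨ cong (map g ∘ filterᵇ (flagAt u)) (sym (List.applyUpTo-∷ʳ suc a)) ⟩
      map g (filterᵇ (flagAt u) (applyUpTo suc a ++ [ suc a ]))
        ≡⟨ cong (map g) (List.filter-++ (T? ∘ flagAt u) (applyUpTo suc a) [ suc a ]) ⟩
      map g (filterᵇ (flagAt u) (applyUpTo suc a) ++ filterᵇ (flagAt u) [ suc a ])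
        ≡⟨ List.map-++ g (filterᵇ (flagAt u) (applyUpTo suc a)) _ ⟩
      indexedRUpTo a ++ map g (filterᵇ (flagAt u) [ suc a ])
        ≡⟨ cong (indexedRUpTo a ++_) last ⟩
      indexedRUpTo a ++ (if flagAt u (suc a) then [ g (suc a) ] else [])
        ∎
      where
      open ≡-Reasoning
      g : ℕ → ℕ × Aff
      g i = i , tElt n u i
      last : map g (filterᵇ (flagAt u) [ suc a ]) ≡ (if flagAt u (suc a) then [ g (suc a) ] else [])
      last with flagAt u (suc a)
      ... | true  = refl
      ... | false = refl

    indexedRUpTo-split : ∀ a {P p rest} → indexedRUpTo a ≡ P ++ p ∷ rest → ∃ λ b → p ≡ (suc b , tElt n u (suc b)) × P ≡ indexedRUpTo b
    indexedRUpTo-split zero    {[]}    ()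
    indexedRUpTo-split zero    {_ ∷ _} ()
    indexedRUpTo-split (suc a) e with flagAt u (suc a) | indexedRUpTo-suc a
    ... | false | snoc = indexedRUpTo-split a (trans (sym (trans snoc (List.++-identityʳ (indexedRUpTo a)))) e)
    ... | true  | snoc with ∷ʳ-split (trans (sym snoc) e)
    ...   | inj₁ (P≡ , p≡)     = a , p≡ , P≡
    ...   | inj₂ (_ , earlier) = indexedRUpTo-split a earlier

    uLetter-invertible : ∀ a → Invertible (uLetter n u (suc a))
    uLetter-invertible a with flagAt u (suc a)
    ... | true  = (λ _ → refl) , (λ _ → refl)
    ... | false = s-involutive a , s-involutive a

    uPrefix-invertible : ∀ a → Invertible (uPrefix n u a)
    uPrefix-invertible zero    = (λ _ → refl) , (λ _ → refl)
    uPrefix-invertible (suc a) =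
      ·-invertible {uPrefix n u a} {uLetter n u (suc a)} (uPrefix-invertible a) (uLetter-invertible a)

    tElt-involutive : ∀ a → Involutive (fwd (tElt n u (suc a)))
    tElt-involutive a x = begin
      U (s a (U⁻¹ (U (s a (U⁻¹ x))))) ≡⟨ cong (U ∘ s a) (proj₂ (uPrefix-invertible a) _) ⟩
      U (s a (s a (U⁻¹ x)))           ≡⟨ cong U (s-involutive a _) ⟩
      U (U⁻¹ x)                       ≡⟨ proj₁ (uPrefix-invertible a) x ⟩
      x                               ∎
      where
      open ≡-Reasoning
      U U⁻¹ : ℤ → ℤ
      U   = fwd (uPrefix n u a)
      U⁻¹ = bwd (uPrefix n u a)

    rUpTo : ℕ → List Aff
    rUpTo a = map proj₂ (indexedRUpTo a)

    rUpTo-involutive : ∀ b → All (Involutive ∘ fwd) (rUpTo b)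
    rUpTo-involutive b = All.map⁺ (All.map⁺ (All.filter⁺ (T? ∘ flagAt u) (All.applyUpTo⁺₂ suc b tElt-involutive)))

    rUpTo-prefix : ∀ a x → fwd (prod (rUpTo a)) (fwd (uPrefix n u a) x) ≡ fullPrefix a x
    rUpTo-prefix zero    x = refl
    rUpTo-prefix (suc a) x with flagAt u (suc a) | indexedRUpTo-suc a
    ... | false | snoc = begin
      fwd (prod (rUpTo (suc a))) (U (s a x))  ≡⟨ cong (λ l → fwd (prod (map proj₂ l)) (U (s a x))) (trans snoc (List.++-identityʳ _)) ⟩
      fwd (prod (rUpTo a)) (U (s a x))        ≡⟨ rUpTo-prefix a (s a x) ⟩
      fullPrefix a (s a x)                 ∎
      where
      open ≡-Reasoning
      U : ℤ → ℤ
      U = fwd (uPrefix n u a)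
    ... | true  | snoc = begin
      fwd (prod (rUpTo (suc a))) (U x)
        ≡⟨ cong (λ l → fwd (prod l) (U x)) (trans (cong (map proj₂) snoc) (List.map-++ proj₂ (indexedRUpTo a) _)) ⟩
      fwd (prod (rUpTo a ++ [ tElt n u (suc a) ])) (U x)
        ≡⟨ prod-++ (rUpTo a) _ (U x) ⟩
      fwd (prod (rUpTo a)) (U (s a (U⁻¹ (U x))))
        ≡⟨ cong (fwd (prod (rUpTo a)) ∘ U ∘ s a) (proj₂ (uPrefix-invertible a) x) ⟩
      fwd (prod (rUpTo a)) (U (s a x))
        ≡⟨ rUpTo-prefix a (s a x) ⟩
      fullPrefix a (s a x)
        ∎
      where
      open ≡-Reasoning
      U U⁻¹ : ℤ → ℤ
      U   = fwd (uPrefix n u a)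
      U⁻¹ = bwd (uPrefix n u a)

    rUpTo-conjugate : ∀ b x → fwd (prod (rUpTo b) · tElt n u (suc b) · prod (reverse (rUpTo b))) x ≡ transpFun n (+ 0) (+ partner b) x
    rUpTo-conjugate b x = begin
      R (U (s b (U⁻¹ (R⁻¹ x))))         ≡⟨ rUpTo-prefix b _ ⟩
      fullPrefix b (s b (U⁻¹ (R⁻¹ x)))  ≡⟨ fullPrefix-conjugate b _ ⟩
      τ (fullPrefix b (U⁻¹ (R⁻¹ x)))    ≡⟨ cong τ (rUpTo-prefix b _) ⟨
      τ (R (U (U⁻¹ (R⁻¹ x))))           ≡⟨ cong (τ ∘ R) (proj₁ (uPrefix-invertible b) _) ⟩
      τ (R (R⁻¹ x))                     ≡⟨ cong τ (prod-reverse (rUpTo-involutive b) x) ⟩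
      τ x                               ∎
      where
      open ≡-Reasoning
      R R⁻¹ U U⁻¹ τ : ℤ → ℤ
      R   = fwd (prod (rUpTo b))
      R⁻¹ = fwd (prod (reverse (rUpTo b)))
      U   = fwd (uPrefix n u b)
      U⁻¹ = bwd (uPrefix n u b)
      τ   = transpFun n (+ 0) (+ partner b)

open LambdaWord using (module Subword)

open import Data.Nat using (_+_)

lemma5p16 : (n : ℕ) → 2 ≤ n → (u : Vec Bool (wordLength n)) →
    (j : Fin (length (rWithIndex n (toList u)))) → (x : ℤ) →
    fwd (prod (map proj₂ (take (toℕ j) (rWithIndex n (toList u))))
         · proj₂ (lookup (rWithIndex n (toList u)) j)
         · prod (reverse (map proj₂ (take (toℕ j) (rWithIndex n (toList u)))))) x
      ≡ fwd ⦅ + 0 , + (proj₁ (lookup (rWithIndex n (toList u)) j)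
                        + ((proj₁ (lookup (rWithIndex n (toList u)) j) ∸ 1) divN (n ∸ 1))) ⦆[ n ] x
lemma5p16 (suc (suc k)) (s≤s (s≤s z≤n)) u j x
  with Subword.indexedRUpTo-split k (toList u) (wordLength (suc (suc k)))
         (take-lookup-drop (rWithIndex (suc (suc k)) (toList u)) j)
... | b , lookup≡ , take≡ rewrite lookup≡ | take≡ = Subword.rUpTo-conjugate k (toList u) b x
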